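{- Let $G=\{g_1:=0,g_2,\ldots,g_n\}$ be a finite Abelian group of order $n\ge15$, let $A_{n-1}=\{{\boldsymbol x}\in\mathbb{Z}^n:\sum_{i=1}^n x_i=0\}$ and $$L_G=\Big\{{\boldsymbol x}=(x_1,\ldots,x_n)\in A_{n-1}:\ \sum_{j=2}^n x_j g_j=0\Big\}.$$ Then $S(L_G^{\#})=S(A_{n-1}^{\#})$.
   Context: Let $V=\{{\boldsymbol x}\in\mathbb{R}^n:\sum x_i=0\}=\operatorname{span}_{\mathbb R}L_G=\operatorname{span}_{\mathbb R}A_{n-1}$. For a full-rank lattice $L\subset V$, its dual is $L^{\#}=\{{\boldsymbol v}\in V:({\boldsymbol v},{\boldsymbol x})\in\mathbb{Z}\text{ for all }{\boldsymbol x}\in L\}$. For a lattice $\Lambda$, $S(\Lambda)$ is the set of nonzero vectors of $\Lambda$ of minimal Euclidean norm.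
   Formalization: The dual lattices $L_G^{\#}$ and $A_{n-1}^{\#}$ consist of the points of $V$ with rational coordinates rather than all real points of $V$. -}

module Defs where

open import Level using (Level)
open import Data.Nat using (ℕ; zero; suc)
open import Data.Fin using (Fin; zero; suc)
open import Data.Integer as ℤ using (ℤ; +_; -[1+_])
import Data.Rational as ℚ
open import Data.Rational using (ℚ; 0ℚ)
open import Data.Product using (Σ; _×_; ∃)
open import Relation.Nullary using (¬_)
open import Relation.Binary.PropositionalEquality using (_≡_)
open import Algebra.Bundles using (AbelianGroup)
open import Function.Bundles using (_⇔_)

sumℤ : ∀ {n} → (Fin n → ℤ) → ℤ
sumℤ {zero}  f = + 0
sumℤ {suc n} f = f zero ℤ.+ sumℤ (λ i → f (suc i))

sumℚ : ∀ {n} → (Fin n → ℚ) → ℚ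
sumℚ {zero}  f = 0ℚ
sumℚ {suc n} f = f zero ℚ.+ sumℚ (λ i → f (suc i))

_∙_ : ∀ {n} → (Fin n → ℚ) → (Fin n → ℚ) → ℚ
v ∙ w = sumℚ (λ i → v i ℚ.* w i)

toℚ : ∀ {n} → (Fin n → ℤ) → (Fin n → ℚ)
toℚ x i = x i ℚ./ 1

A : (n : ℕ) → (Fin n → ℤ) → Set
A n x = sumℤ x ≡ + 0

inV : (n : ℕ) → (Fin n → ℚ) → Set
inV n v = sumℚ v ≡ 0ℚ

-- dual lattice of a lattice L ⊆ ℤ^n ∩ V, taken inside V
Dual : ∀ {a} (n : ℕ) → ((Fin n → ℤ) → Set a) → (Fin n → ℚ) → Set a
Dual n L v = inV n v × (∀ x → L x → ∃ λ (k : ℤ) → v ∙ toℚ x ≡ k ℚ./ 1)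

NonZeroVec : ∀ {n} → (Fin n → ℚ) → Set
NonZeroVec v = ¬ (∀ i → v i ≡ 0ℚ)

S : ∀ {a} (n : ℕ) → ((Fin n → ℚ) → Set a) → (Fin n → ℚ) → Set a
S n Λ v = Λ v × NonZeroVec v × (∀ w → Λ w → NonZeroVec w → (v ∙ v) ℚ.≤ (w ∙ w))

module _ {c ℓ : Level} (G : AbelianGroup c ℓ) where
  open AbelianGroup G renaming (Carrier to ∣G∣; _∙_ to _⊕_)

  natMul : ℕ → ∣G∣ → ∣G∣
  natMul zero    g = ε
  natMul (suc k) g = g ⊕ natMul k g

  intMul : ℤ → ∣G∣ → ∣G∣
  intMul (+ k)     g = natMul k g
  intMul -[1+ k ]  g = (natMul (suc k) g) ⁻¹

  sumG : ∀ {m} → (Fin m → ∣G∣) → ∣G∣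
  sumG {zero}  f = ε
  sumG {suc m} f = f zero ⊕ sumG (λ i → f (suc i))

  -- n = suc m; g : Fin n → G is an enumeration of G = {g_1,...,g_n} (bijection up to ≈) with g_1 = 0
  record Enumeration (m : ℕ) : Set (c Level.⊔ ℓ) where
    field
      g       : Fin (suc m) → ∣G∣
      inj     : ∀ i j → g i ≈ g j → i ≡ j
      surj    : ∀ a → ∃ λ i → g i ≈ a
      g₁≈0    : g zero ≈ ε

  -- L_G = { x ∈ A_{n-1} : Σ_{j=2}^{n} x_j g_j = 0 }, with n = suc m (index j ↦ suc j)
  L : (m : ℕ) → (Fin (suc m) → ∣G∣) → (Fin (suc m) → ℤ) → Set ℓ
  L m g x = A (suc m) x × (sumG (λ j → intMul (x (suc j)) (g (suc j))) ≈ ε)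

module Submission where

-- Since L_G ⊆ A_{n-1}, we have A_{n-1}^# ⊆ L_G^#, and the minimal vector e_1 − 𝟙/n of A_{n-1}^#,
-- of norm (n − 1)/n, lies in L_G^#. So it suffices that every v ∈ L_G^# with |v|² ≤ (n − 1)/n has
-- integral differences v_i − v_1. As e_c + e_1 − e_b − e_h ∈ L_G whenever g_c = g_b + g_h, the map
-- g_i ↦ v_i − v_1 is a homomorphism G → ℚ/ℤ. If r = v_h − v_1 has reduced denominator q ≥ 2, then
-- for every b the q numbers q·v_{b + k g_h} (0 ≤ k < q) are pairwise at distance ≥ 1, and q reals so
-- separated satisfy q Σ x² − (Σ x)² ≥ (q⁴ − q²)/12. Summing over b, each index occurring q times,
-- gives n (q⁴ − q²)/12 ≤ q⁴ |v|² ≤ q⁴ (n − 1)/n, which is false for n ≥ 15.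

open import Level using (Level; 0ℓ)
open import Algebra.Bundles using (AbelianGroup)
import Algebra.Properties.CommutativeMonoid.Sum as MonoidSum
open import Data.Empty using (⊥-elim)
open import Data.Fin.Base using (Fin; zero; suc; toℕ; fromℕ<; punchIn)
import Data.Fin.Properties as Fin
open import Data.Fin.Permutation using (Permutation′; permutation; _⟨$⟩ʳ_)
open import Data.Integer.Base as ℤ using (ℤ; +_; -[1+_])
import Data.Integer.Properties as ℤ
import Data.Integer.Tactic.RingSolver as ℤ-Solver
open import Data.Nat.Base as ℕ using (ℕ; zero; suc; _≤_)
import Data.Nat.Properties as ℕ
import Data.Nat.Tactic.RingSolver as ℕ-Solver
open import Data.Nat.Coprimality as Coprime using (Coprime; coprime-divisor)
open import Data.Nat.Divisibility using (divides; ∣⇒≤)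
open import Data.Product.Base using (Σ; ∃; _×_; _,_; proj₁; proj₂; map₂)
open import Data.Rational.Base as ℚ using (ℚ; 0ℚ; 1ℚ; _+_; _*_; _-_; -_; mkℚ; ↥_; ↧ₙ_)
import Data.Rational.Properties as ℚ
import Data.Rational.Unnormalised.Base as ℚᵘ
import Data.Rational.Unnormalised.Properties as ℚᵘ
open import Data.Sum.Base using (_⊎_; inj₁; inj₂; [_,_]′)
open import Function.Base using (_∘_)
open import Function.Bundles using (_⇔_; mk⇔)
open import Relation.Binary.PropositionalEquality as ≡
  using (_≡_; _≢_; refl; cong; cong₂; subst; subst₂; ≢-sym)
import Relation.Binary.Reasoning.Setoid as ≈-Reasoning
open import Relation.Nullary.Decidable using (dec⇒maybe)
open import Relation.Nullary.Negation using (¬_)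
open import Tactic.RingSolver using (solve-∀)
import Tactic.RingSolver.Core.AlmostCommutativeRing as ACR

open import Defs

module ∑ = MonoidSum ℚ.+-0-commutativeMonoid

ℚ-ring : ACR.AlmostCommutativeRing 0ℓ 0ℓ
ℚ-ring = ACR.fromCommutativeRing ℚ.+-*-commutativeRing (λ x → dec⇒maybe (0ℚ ℚ.≟ x))

ι : ℤ → ℚ
ι k = k ℚ./ 1

ιn : ℕ → ℚ
ιn k = ι (+ k)

toℚᵘ-ι : ∀ k → ℚ.toℚᵘ (ι k) ℚᵘ.≃ ℚᵘ.mkℚᵘ k 0
toℚᵘ-ι k = ℚ.toℚᵘ-fromℚᵘ (ℚᵘ.mkℚᵘ k 0)

ι-+ : ∀ a b → ι (a ℤ.+ b) ≡ ι a + ι b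
ι-+ a b = ℚ.toℚᵘ-injective (begin
  ℚ.toℚᵘ (ι (a ℤ.+ b))                ≈⟨ toℚᵘ-ι (a ℤ.+ b) ⟩
  ℚᵘ.mkℚᵘ (a ℤ.+ b) 0                 ≈⟨ ℚᵘ.*≡* (cross a b) ⟩
  ℚᵘ.mkℚᵘ a 0 ℚᵘ.+ ℚᵘ.mkℚᵘ b 0        ≈⟨ ℚᵘ.+-cong (toℚᵘ-ι a) (toℚᵘ-ι b) ⟨
  ℚ.toℚᵘ (ι a) ℚᵘ.+ ℚ.toℚᵘ (ι b)      ≈⟨ ℚ.toℚᵘ-homo-+ (ι a) (ι b) ⟨
  ℚ.toℚᵘ (ι a + ι b)                  ∎)
  where
  open ≈-Reasoning ℚᵘ.≃-setoid
  cross : ∀ a b → (a ℤ.+ b) ℤ.* + 1 ≡ (a ℤ.* + 1 ℤ.+ b ℤ.* + 1) ℤ.* + 1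
  cross = ℤ-Solver.solve-∀

ι-* : ∀ a b → ι (a ℤ.* b) ≡ ι a * ι b
ι-* a b = ℚ.toℚᵘ-injective (begin
  ℚ.toℚᵘ (ι (a ℤ.* b))                ≈⟨ toℚᵘ-ι (a ℤ.* b) ⟩
  ℚᵘ.mkℚᵘ (a ℤ.* b) 0                 ≈⟨ ℚᵘ.*≡* refl ⟩
  ℚᵘ.mkℚᵘ a 0 ℚᵘ.* ℚᵘ.mkℚᵘ b 0        ≈⟨ ℚᵘ.*-cong (toℚᵘ-ι a) (toℚᵘ-ι b) ⟨
  ℚ.toℚᵘ (ι a) ℚᵘ.* ℚ.toℚᵘ (ι b)      ≈⟨ ℚ.toℚᵘ-homo-* (ι a) (ι b) ⟨
  ℚ.toℚᵘ (ι a * ι b)                  ∎)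
  where open ≈-Reasoning ℚᵘ.≃-setoid

ι-neg : ∀ a → ι (ℤ.- a) ≡ - ι a
ι-neg a = ℚ.toℚᵘ-injective (ℚᵘ.≃-trans (toℚᵘ-ι (ℤ.- a))
  (ℚᵘ.≃-sym (ℚᵘ.≃-trans (ℚ.toℚᵘ-homo‿- (ι a)) (ℚᵘ.-‿cong (toℚᵘ-ι a)))))

ι-- : ∀ a b → ι (a ℤ.- b) ≡ ι a - ι b
ι-- a b = ≡.trans (ι-+ a (ℤ.- b)) (cong (λ x → ι a + x) (ι-neg b))

ι-mono-≤ : ∀ {a b} → a ℤ.≤ b → ι a ℚ.≤ ι b
ι-mono-≤ {a} {b} a≤b = ℚ.toℚᵘ-cancel-≤
  (ℚᵘ.≤-respʳ-≃ (ℚᵘ.≃-sym (toℚᵘ-ι b)) (ℚᵘ.≤-respˡ-≃ (ℚᵘ.≃-sym (toℚᵘ-ι a))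
    (ℚᵘ.*≤* (ℤ.*-monoʳ-≤-nonNeg (+ 1) a≤b))))

ι-cancel-≤ : ∀ {a b} → ι a ℚ.≤ ι b → a ℤ.≤ b
ι-cancel-≤ {a} {b} ιa≤ιb
  with ℚᵘ.≤-respʳ-≃ (toℚᵘ-ι b) (ℚᵘ.≤-respˡ-≃ (toℚᵘ-ι a) (ℚ.toℚᵘ-mono-≤ ιa≤ιb))
... | ℚᵘ.*≤* a*1≤b*1 = subst₂ ℤ._≤_ (ℤ.*-identityʳ a) (ℤ.*-identityʳ b) a*1≤b*1

ι-injective : ∀ {a b} → ι a ≡ ι b → a ≡ b
ι-injective eq = ℤ.≤-antisym (ι-cancel-≤ (ℚ.≤-reflexive eq)) (ι-cancel-≤ (ℚ.≤-reflexive (≡.sym eq)))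

/-*-cancel : ∀ p d → (p ℚ./ suc d) * ιn (suc d) ≡ ι p
/-*-cancel p d = ℚ.toℚᵘ-injective (begin
  ℚ.toℚᵘ ((p ℚ./ suc d) * ιn (suc d))              ≈⟨ ℚ.toℚᵘ-homo-* (p ℚ./ suc d) (ιn (suc d)) ⟩
  ℚ.toℚᵘ (p ℚ./ suc d) ℚᵘ.* ℚ.toℚᵘ (ιn (suc d))    ≈⟨ ℚᵘ.*-cong (ℚ.toℚᵘ-fromℚᵘ (ℚᵘ.mkℚᵘ p d)) (toℚᵘ-ι (+ suc d)) ⟩
  ℚᵘ.mkℚᵘ p d ℚᵘ.* ℚᵘ.mkℚᵘ (+ suc d) 0             ≈⟨ ℚᵘ.*≡* cross ⟩
  ℚᵘ.mkℚᵘ p 0                                      ≈⟨ toℚᵘ-ι p ⟨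
  ℚ.toℚᵘ (ι p)                                     ∎)
  where
  open ≈-Reasoning ℚᵘ.≃-setoid
  cross : (p ℤ.* + suc d) ℤ.* + 1 ≡ p ℤ.* (+ suc d ℤ.* + 1)
  cross = ℤ.*-assoc p (+ suc d) (+ 1)

↥-↧-coprime : ∀ r → Coprime ℤ.∣ ↥ r ∣ (↧ₙ r)
↥-↧-coprime (mkℚ _ _ coprime) = Coprime.recompute coprime

*-denominator : ∀ r → r * ιn (↧ₙ r) ≡ ι (↥ r)
*-denominator r@(mkℚ p d _) = ≡.trans (cong (_* ιn (suc d)) (≡.sym (ℚ.↥p/↧p≡p r))) (/-*-cancel p d)

ιn-+ : ∀ a b → ιn (a ℕ.+ b) ≡ ιn a + ιn b
ιn-+ a b = ≡.trans (cong ι (ℤ.pos-+ a b)) (ι-+ (+ a) (+ b))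

ιn-* : ∀ a b → ιn (a ℕ.* b) ≡ ιn a * ιn b
ιn-* a b = ≡.trans (cong ι (ℤ.pos-* a b)) (ι-* (+ a) (+ b))

ιn-suc : ∀ a → ιn (suc a) ≡ 1ℚ + ιn a
ιn-suc a = ι-+ (+ 1) (+ a)

ιn-nonNeg : ∀ a → 0ℚ ℚ.≤ ιn a
ιn-nonNeg a = ι-mono-≤ {+ 0} {+ a} (ℤ.+≤+ ℕ.z≤n)

ιn-cancel-≤ : ∀ {a b} → ιn a ℚ.≤ ιn b → a ℕ.≤ b
ιn-cancel-≤ ιa≤ιb = ℤ.drop‿+≤+ (ι-cancel-≤ ιa≤ιb)

module _ {c ℓ : Level} (G : AbelianGroup c ℓ) where
  open AbelianGroup G renaming (Carrier to ∣G∣; refl to ≈-refl; sym to ≈-sym; trans to ≈-trans; _∙_ to _⊕_)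
  open import Algebra.Properties.AbelianGroup G using (ε⁻¹≈ε; ⁻¹-involutive; xyx⁻¹≈y; ⁻¹-∙-comm)
  open import Algebra.Properties.CommutativeSemigroup commutativeSemigroup using (interchange)
  open ≈-Reasoning setoid

  natMul-+ : ∀ a b y → natMul G (a ℕ.+ b) y ≈ natMul G a y ⊕ natMul G b y
  natMul-+ zero    b y = ≈-sym (identityˡ _)
  natMul-+ (suc a) b y = ≈-trans (∙-congˡ (natMul-+ a b y)) (≈-sym (assoc _ _ _))

  intMul-⊖ : ∀ a b y → intMul G (a ℤ.⊖ b) y ≈ natMul G a y ⊕ natMul G b y ⁻¹
  intMul-⊖ zero    zero    y = ≈-sym (≈-trans (∙-congˡ ε⁻¹≈ε) (identityʳ ε))
  intMul-⊖ zero    (suc b) y = ≈-sym (identityˡ _)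
  intMul-⊖ (suc a) zero    y = ≈-sym (≈-trans (∙-congˡ ε⁻¹≈ε) (identityʳ _))
  intMul-⊖ (suc a) (suc b) y = begin
    intMul G (suc a ℤ.⊖ suc b) y                 ≡⟨ cong (λ k → intMul G k y) (ℤ.[1+m]⊖[1+n]≡m⊖n a b) ⟩
    intMul G (a ℤ.⊖ b) y                         ≈⟨ intMul-⊖ a b y ⟩
    natMul G a y ⊕ natMul G b y ⁻¹               ≈⟨ ∙-congʳ (xyx⁻¹≈y y (natMul G a y)) ⟨
    (y ⊕ natMul G a y ⊕ y ⁻¹) ⊕ natMul G b y ⁻¹  ≈⟨ assoc _ _ _ ⟩
    (y ⊕ natMul G a y) ⊕ (y ⁻¹ ⊕ natMul G b y ⁻¹) ≈⟨ ∙-congˡ (⁻¹-∙-comm y (natMul G b y)) ⟩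
    natMul G (suc a) y ⊕ natMul G (suc b) y ⁻¹   ∎

  intMul-+ : ∀ a b y → intMul G (a ℤ.+ b) y ≈ intMul G a y ⊕ intMul G b y
  intMul-+ (+ a)    (+ b)    y = natMul-+ a b y
  intMul-+ (+ a)    -[1+ b ] y = intMul-⊖ a (suc b) y
  intMul-+ -[1+ a ] (+ b)    y = ≈-trans (intMul-⊖ b (suc a) y) (comm _ _)
  intMul-+ -[1+ a ] -[1+ b ] y = begin
    natMul G (suc (suc (a ℕ.+ b))) y ⁻¹            ≡⟨ cong (λ k → natMul G (suc k) y ⁻¹) (ℕ.+-suc a b) ⟨
    natMul G (suc a ℕ.+ suc b) y ⁻¹                ≈⟨ ⁻¹-cong (natMul-+ (suc a) (suc b) y) ⟩
    (natMul G (suc a) y ⊕ natMul G (suc b) y) ⁻¹   ≈⟨ ⁻¹-∙-comm _ _ ⟨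
    natMul G (suc a) y ⁻¹ ⊕ natMul G (suc b) y ⁻¹  ∎

  intMul-neg : ∀ a y → intMul G (ℤ.- a) y ≈ intMul G a y ⁻¹
  intMul-neg (+ zero)  y = ≈-sym ε⁻¹≈ε
  intMul-neg (+ suc a) y = ≈-refl
  intMul-neg -[1+ a ]  y = ≈-sym (⁻¹-involutive _)

  intMul-- : ∀ a b y → intMul G (a ℤ.- b) y ≈ intMul G a y ⊕ intMul G b y ⁻¹
  intMul-- a b y = ≈-trans (intMul-+ a (ℤ.- b) y) (∙-congˡ (intMul-neg b y))

  sumG-cong : ∀ {k} {f h : Fin k → ∣G∣} → (∀ i → f i ≈ h i) → sumG G f ≈ sumG G h
  sumG-cong {zero}  f≈h = ≈-refl
  sumG-cong {suc k} f≈h = ∙-cong (f≈h zero) (sumG-cong (f≈h ∘ suc))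

  sumG-ε : ∀ {k} (f : Fin k → ∣G∣) → (∀ i → f i ≈ ε) → sumG G f ≈ ε
  sumG-ε {zero}  f f≈ε = ≈-refl
  sumG-ε {suc k} f f≈ε = ≈-trans (∙-cong (f≈ε zero) (sumG-ε (f ∘ suc) (f≈ε ∘ suc))) (identityˡ ε)

  sumG-⊕ : ∀ {k} (f h : Fin k → ∣G∣) → sumG G (λ i → f i ⊕ h i) ≈ sumG G f ⊕ sumG G h
  sumG-⊕ {zero}  f h = ≈-sym (identityˡ ε)
  sumG-⊕ {suc k} f h = begin
    (f zero ⊕ h zero) ⊕ sumG G (λ i → f (suc i) ⊕ h (suc i))   ≈⟨ ∙-congˡ (sumG-⊕ (f ∘ suc) (h ∘ suc)) ⟩
    (f zero ⊕ h zero) ⊕ (sumG G (f ∘ suc) ⊕ sumG G (h ∘ suc))  ≈⟨ interchange _ _ _ _ ⟩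
    (f zero ⊕ sumG G (f ∘ suc)) ⊕ (h zero ⊕ sumG G (h ∘ suc))  ∎

  sumG-⁻¹ : ∀ {k} (f : Fin k → ∣G∣) → sumG G (λ i → f i ⁻¹) ≈ sumG G f ⁻¹
  sumG-⁻¹ {zero}  f = ≈-sym ε⁻¹≈ε
  sumG-⁻¹ {suc k} f = ≈-trans (∙-congˡ (sumG-⁻¹ (f ∘ suc))) (⁻¹-∙-comm _ _)

  sumG-single : ∀ {k} (f : Fin k → ∣G∣) c → (∀ i → c ≢ i → f i ≈ ε) → sumG G f ≈ f c
  sumG-single f zero    off = ≈-trans (∙-congˡ (sumG-ε (f ∘ suc) (λ i → off (suc i) (λ ())))) (identityʳ _)
  sumG-single f (suc c) off = ≈-trans (∙-congʳ (off zero (λ ())))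
    (≈-trans (identityˡ _) (sumG-single (f ∘ suc) c (λ i c≢i → off (suc i) (c≢i ∘ Fin.suc-injective))))

δ : ∀ {k} → Fin k → Fin k → ℤ
δ zero    zero    = + 1
δ zero    (suc _) = + 0
δ (suc _) zero    = + 0
δ (suc c) (suc i) = δ c i

δ-diag : ∀ {k} (c : Fin k) → δ c c ≡ + 1
δ-diag zero    = refl
δ-diag (suc c) = δ-diag c

δ-off : ∀ {k} {c i : Fin k} → c ≢ i → δ c i ≡ + 0
δ-off {c = zero}  {zero}  c≢i = ⊥-elim (c≢i refl)
δ-off {c = zero}  {suc i} c≢i = refl
δ-off {c = suc c} {zero}  c≢i = refl
δ-off {c = suc c} {suc i} c≢i = δ-off (c≢i ∘ cong suc)

ℚ⁺ : AbelianGroup 0ℓ 0ℓ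
ℚ⁺ = ℚ.+-0-abelianGroup

sumℚ≡sumG : ∀ {k} (f : Fin k → ℚ) → sumℚ f ≡ sumG ℚ⁺ f
sumℚ≡sumG {zero}  f = refl
sumℚ≡sumG {suc k} f = cong (λ s → f zero + s) (sumℚ≡sumG (f ∘ suc))

sumℚ≡∑ : ∀ {k} (f : Fin k → ℚ) → sumℚ f ≡ ∑.sum f
sumℚ≡∑ {zero}  f = refl
sumℚ≡∑ {suc k} f = cong (λ s → f zero + s) (sumℚ≡∑ (f ∘ suc))

sumℚ-cong : ∀ {k} {f h : Fin k → ℚ} → (∀ i → f i ≡ h i) → sumℚ f ≡ sumℚ h
sumℚ-cong {f = f} {h} f≡h =
  ≡.trans (sumℚ≡sumG f) (≡.trans (sumG-cong ℚ⁺ f≡h) (≡.sym (sumℚ≡sumG h)))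

sumℚ-+ : ∀ {k} (f h : Fin k → ℚ) → sumℚ (λ i → f i + h i) ≡ sumℚ f + sumℚ h
sumℚ-+ f h = ≡.trans (sumℚ≡sumG (λ i → f i + h i))
  (≡.trans (sumG-⊕ ℚ⁺ f h) (≡.sym (cong₂ _+_ (sumℚ≡sumG f) (sumℚ≡sumG h))))

sumℚ-neg : ∀ {k} (f : Fin k → ℚ) → sumℚ (λ i → - f i) ≡ - sumℚ f
sumℚ-neg f = ≡.trans (sumℚ≡sumG (-_ ∘ f)) (≡.trans (sumG-⁻¹ ℚ⁺ f) (≡.sym (cong -_ (sumℚ≡sumG f))))

sumℚ-- : ∀ {k} (f h : Fin k → ℚ) → sumℚ (λ i → f i - h i) ≡ sumℚ f - sumℚ h
sumℚ-- f h = ≡.trans (sumℚ-+ f (-_ ∘ h)) (cong (λ s → sumℚ f + s) (sumℚ-neg h))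

sumℚ-single : ∀ {k} (f : Fin k → ℚ) c → (∀ i → c ≢ i → f i ≡ 0ℚ) → sumℚ f ≡ f c
sumℚ-single f c off = ≡.trans (sumℚ≡sumG f) (sumG-single ℚ⁺ f c off)

sumℚ-*ˡ : ∀ {k} a (f : Fin k → ℚ) → sumℚ (λ i → a * f i) ≡ a * sumℚ f
sumℚ-*ˡ {zero}  a f = ≡.sym (ℚ.*-zeroʳ a)
sumℚ-*ˡ {suc k} a f =
  ≡.trans (cong (λ s → a * f zero + s) (sumℚ-*ˡ a (f ∘ suc))) (≡.sym (ℚ.*-distribˡ-+ a (f zero) _))

sumℚ-const : ∀ k a → sumℚ {k} (λ _ → a) ≡ ιn k * a
sumℚ-const zero    a = ≡.sym (ℚ.*-zeroˡ a)
sumℚ-const (suc k) a = begin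
  a + sumℚ {k} (λ _ → a)   ≡⟨ cong (λ s → a + s) (sumℚ-const k a) ⟩
  a + ιn k * a             ≡⟨ factor a (ιn k) ⟩
  (1ℚ + ιn k) * a          ≡⟨ cong (_* a) (ιn-suc k) ⟨
  ιn (suc k) * a           ∎
  where
  open ≡.≡-Reasoning
  factor : ∀ a x → a + x * a ≡ (1ℚ + x) * a
  factor = solve-∀ ℚ-ring

sumℚ-mono-≤ : ∀ {k} {f h : Fin k → ℚ} → (∀ i → f i ℚ.≤ h i) → sumℚ f ℚ.≤ sumℚ h
sumℚ-mono-≤ {zero}  f≤h = ℚ.≤-refl
sumℚ-mono-≤ {suc k} f≤h = ℚ.+-mono-≤ (f≤h zero) (sumℚ-mono-≤ (f≤h ∘ suc))

sumℚ-ι : ∀ {k} (x : Fin k → ℤ) → sumℚ (toℚ x) ≡ ι (sumℤ x)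
sumℚ-ι {zero}  x = refl
sumℚ-ι {suc k} x = ≡.trans (cong (λ s → ι (x zero) + s) (sumℚ-ι (x ∘ suc))) (≡.sym (ι-+ (x zero) _))

sumℚ-remove : ∀ {k} (f : Fin (suc k) → ℚ) i → sumℚ f ≡ f i + sumℚ (f ∘ punchIn i)
sumℚ-remove f i = ≡.trans (sumℚ≡∑ f)
  (≡.trans (∑.sum-remove {i = i} f) (cong (λ s → f i + s) (≡.sym (sumℚ≡∑ (f ∘ punchIn i)))))

sumℚ-comm : ∀ {k l} (f : Fin k → Fin l → ℚ) →
            sumℚ (λ i → sumℚ (λ j → f i j)) ≡ sumℚ (λ j → sumℚ (λ i → f i j))
sumℚ-comm f = begin
  sumℚ (λ i → sumℚ (λ j → f i j))    ≡⟨ sumℚ-cong (λ i → sumℚ≡∑ (f i)) ⟩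
  sumℚ (λ i → ∑.sum (f i))           ≡⟨ sumℚ≡∑ (λ i → ∑.sum (f i)) ⟩
  ∑.sum (λ i → ∑.sum (f i))          ≡⟨ ∑.∑-comm f ⟩
  ∑.sum (λ j → ∑.sum (λ i → f i j))  ≡⟨ sumℚ≡∑ (λ j → ∑.sum (λ i → f i j)) ⟨
  sumℚ (λ j → ∑.sum (λ i → f i j))   ≡⟨ sumℚ-cong (λ j → sumℚ≡∑ (λ i → f i j)) ⟨
  sumℚ (λ j → sumℚ (λ i → f i j))    ∎
  where open ≡.≡-Reasoning

sumℚ-permute : ∀ {k} (f : Fin k → ℚ) (π : Permutation′ k) → sumℚ (f ∘ (π ⟨$⟩ʳ_)) ≡ sumℚ f
sumℚ-permute f π = ≡.trans (sumℚ≡∑ (f ∘ (π ⟨$⟩ʳ_)))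
  (≡.trans (≡.sym (∑.sum-permute f π)) (≡.sym (sumℚ≡∑ f)))

≤⇒0≤- : ∀ {p q} → p ℚ.≤ q → 0ℚ ℚ.≤ q - p
≤⇒0≤- {p} {q} p≤q = subst (ℚ._≤ q - p) (ℚ.+-inverseʳ p) (ℚ.+-monoˡ-≤ (- p) p≤q)

0≤-⇒≤ : ∀ {p q} → 0ℚ ℚ.≤ q - p → p ℚ.≤ q
0≤-⇒≤ {p} {q} 0≤q-p = subst₂ ℚ._≤_ (ℚ.+-identityˡ p) (cancel p q) (ℚ.+-monoˡ-≤ p 0≤q-p)
  where
  cancel : ∀ p q → q - p + p ≡ q
  cancel = solve-∀ ℚ-ring

sq : ℚ → ℚ
sq x = x * x

sq-nonNeg : ∀ x → 0ℚ ℚ.≤ sq x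
sq-nonNeg x with ℚ.≤-total 0ℚ x
... | inj₁ 0≤x = ℚ.nonNegative⁻¹ _ {{ℚ.nonNeg*nonNeg⇒nonNeg x {{ℚ.nonNegative 0≤x}} x {{ℚ.nonNegative 0≤x}}}}
... | inj₂ x≤0 = ℚ.nonNegative⁻¹ _ {{ℚ.nonPos*nonPos⇒nonPos x {{ℚ.nonPositive x≤0}} x {{ℚ.nonPositive x≤0}}}}

-sq-≤ : ∀ a s → a - sq s ℚ.≤ a
-sq-≤ a s = 0≤-⇒≤ (subst (0ℚ ℚ.≤_) (≡.sym (cancel a (sq s))) (sq-nonNeg s))
  where
  cancel : ∀ a t → a - (a - t) ≡ t
  cancel = solve-∀ ℚ-ring

sq-mono-≤ : ∀ {a b} → 0ℚ ℚ.≤ a → a ℚ.≤ b → sq a ℚ.≤ sq b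
sq-mono-≤ {a} {b} 0≤a a≤b = ℚ.≤-trans (ℚ.*-monoˡ-≤-nonNeg a {{ℚ.nonNegative 0≤a}} a≤b)
  (ℚ.*-monoʳ-≤-nonNeg b {{ℚ.nonNegative (ℚ.≤-trans 0≤a a≤b)}} a≤b)

Separated : ∀ {r} → (Fin r → ℚ) → Set
Separated X = ∀ i j → i ≢ j → 1ℚ ℚ.≤ X j - X i ⊎ 1ℚ ℚ.≤ X i - X j

Separated-punchIn : ∀ {r} {X : Fin (suc r) → ℚ} i → Separated X → Separated (X ∘ punchIn i)
Separated-punchIn i sep j k j≢k = sep (punchIn i j) (punchIn i k) (j≢k ∘ Fin.punchIn-injective i j k)

argmin : ∀ {r} (X : Fin (suc r) → ℚ) → Σ (Fin (suc r)) λ i → ∀ j → X i ℚ.≤ X j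
argmin {zero}  X = zero , λ { zero → ℚ.≤-refl }
argmin {suc r} X with argmin (X ∘ suc)
... | i , min with ℚ.≤-total (X zero) (X (suc i))
...   | inj₁ X₀≤ = zero  , λ { zero → ℚ.≤-refl ; (suc j) → ℚ.≤-trans X₀≤ (min j) }
...   | inj₂ ≤X₀ = suc i , λ { zero → ≤X₀ ; (suc j) → min j }

Separated-min-gap : ∀ {r} {X : Fin (suc r) → ℚ} i → (∀ j → X i ℚ.≤ X j) → Separated X →
                    ∀ k → 1ℚ ℚ.≤ X (punchIn i k) - X i
Separated-min-gap {X = X} i min sep k with sep i (punchIn i k) (≢-sym (Fin.punchInᵢ≢i i k))
... | inj₁ gap = gap
... | inj₂ gap = ⊥-elim (1+0≰0 (subst (1ℚ + 0ℚ ℚ.≤_) (cancel (X i) (X (punchIn i k)))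
                                      (ℚ.+-mono-≤ gap (≤⇒0≤- (min (punchIn i k))))))
  where
  cancel : ∀ a b → (a - b) + (b - a) ≡ 0ℚ
  cancel = solve-∀ ℚ-ring
  1+0≰0 : ¬ (1ℚ + 0ℚ ℚ.≤ 0ℚ)
  1+0≰0 (ℚ.*≤* (ℤ.+≤+ ()))

sumOfSquaresFrom : ℕ → ℕ → ℕ
sumOfSquaresFrom j zero    = 0
sumOfSquaresFrom j (suc r) = j ℕ.* j ℕ.+ sumOfSquaresFrom (suc j) r

Separated-sumSq-≥ : ∀ r (Y : Fin r → ℚ) a j → Separated Y → (∀ k → ιn j ℚ.≤ Y k - a) →
                    ιn (sumOfSquaresFrom j r) ℚ.≤ sumℚ (λ k → sq (Y k - a))
Separated-sumSq-≥ zero    Y a j sep above = ℚ.≤-refl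
Separated-sumSq-≥ (suc r) Y a j sep above with argmin Y
... | i , min = begin
  ιn (j ℕ.* j ℕ.+ sumOfSquaresFrom (suc j) r)                   ≡⟨ ≡.trans (ιn-+ (j ℕ.* j) _) (cong (_+ ιn (sumOfSquaresFrom (suc j) r)) (ιn-* j j)) ⟩
  sq (ιn j) + ιn (sumOfSquaresFrom (suc j) r)                   ≤⟨ ℚ.+-mono-≤ nearest rest ⟩
  sq (Y i - a) + sumℚ (λ k → sq (Y (punchIn i k) - a))          ≡⟨ sumℚ-remove (λ k → sq (Y k - a)) i ⟨
  sumℚ (λ k → sq (Y k - a))                                     ∎
  where
  open ℚ.≤-Reasoning
  nearest : sq (ιn j) ℚ.≤ sq (Y i - a)
  nearest = sq-mono-≤ (ιn-nonNeg j) (above i)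
  telescope : ∀ a y z → (y - a) + (z - y) ≡ z - a
  telescope = solve-∀ ℚ-ring
  above′ : ∀ k → ιn (suc j) ℚ.≤ Y (punchIn i k) - a
  above′ k = subst₂ ℚ._≤_ (≡.trans (ℚ.+-comm (ιn j) 1ℚ) (≡.sym (ιn-suc j)))
                         (telescope a (Y i) (Y (punchIn i k)))
                         (ℚ.+-mono-≤ (above i) (Separated-min-gap i min sep k))
  rest : ιn (sumOfSquaresFrom (suc j) r) ℚ.≤ sumℚ (λ k → sq (Y (punchIn i k) - a))
  rest = Separated-sumSq-≥ r (Y ∘ punchIn i) a (suc j) (Separated-punchIn {X = Y} i sep) above′

sumℚ-sq-shift : ∀ {r} (Y : Fin r → ℚ) a →
  sumℚ (λ k → sq (Y k - a)) ≡ sumℚ (λ k → sq (Y k)) - (a + a) * sumℚ Y + ιn r * sq a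
sumℚ-sq-shift {r} Y a = begin
  sumℚ (λ k → sq (Y k - a))                                ≡⟨ sumℚ-cong (λ k → expand (Y k) a) ⟩
  sumℚ (λ k → (sq (Y k) - (a + a) * Y k) + sq a)           ≡⟨ sumℚ-+ (λ k → sq (Y k) - (a + a) * Y k) (λ _ → sq a) ⟩
  sumℚ (λ k → sq (Y k) - (a + a) * Y k) + sumℚ {r} (λ _ → sq a)
    ≡⟨ cong₂ _+_ (≡.trans (sumℚ-- (sq ∘ Y) (λ k → (a + a) * Y k)) (cong (λ t → sumℚ (sq ∘ Y) - t) (sumℚ-*ˡ (a + a) Y)))
                 (sumℚ-const r (sq a)) ⟩
  sumℚ (λ k → sq (Y k)) - (a + a) * sumℚ Y + ιn r * sq a   ∎
  where
  open ≡.≡-Reasoning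
  expand : ∀ y a → (y - a) * (y - a) ≡ (y * y - (a + a) * y) + a * a
  expand = solve-∀ ℚ-ring

-- equals Σ_{i<j} (x_i − x_j)²
scaledVariance : ∀ {r} → (Fin r → ℚ) → ℚ
scaledVariance {r} X = ιn r * sumℚ (λ k → sq (X k)) - sq (sumℚ X)

scaledVariance-remove : ∀ {r} (X : Fin (suc r) → ℚ) i →
  scaledVariance X ≡ scaledVariance (X ∘ punchIn i) + sumℚ (λ k → sq (X (punchIn i k) - X i))
scaledVariance-remove {r} X i = begin
  ιn (suc r) * sumℚ (λ k → sq (X k)) - sq (sumℚ X)
    ≡⟨ cong₂ (λ s t → ιn (suc r) * s - sq t) (sumℚ-remove (sq ∘ X) i) (sumℚ-remove X i) ⟩
  ιn (suc r) * (sq a + ΣY²) - sq (a + ΣY)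
    ≡⟨ cong (λ t → t * (sq a + ΣY²) - sq (a + ΣY)) (ιn-suc r) ⟩
  (1ℚ + ιn r) * (sq a + ΣY²) - sq (a + ΣY)
    ≡⟨ regroup a ΣY² ΣY (ιn r) ⟩
  scaledVariance Y + (ΣY² - (a + a) * ΣY + ιn r * sq a)
    ≡⟨ cong (λ t → scaledVariance Y + t) (sumℚ-sq-shift Y a) ⟨
  scaledVariance Y + sumℚ (λ k → sq (Y k - a)) ∎
  where
  open ≡.≡-Reasoning
  Y : Fin r → ℚ
  Y = X ∘ punchIn i
  a ΣY ΣY² : ℚ
  a = X i
  ΣY = sumℚ Y
  ΣY² = sumℚ (λ k → sq (Y k))
  regroup : ∀ a q s k → (1ℚ + k) * (a * a + q) - (a + s) * (a + s) ≡ (k * q - s * s) + (q - (a + a) * s + k * (a * a))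
  regroup = solve-∀ ℚ-ring

varianceBound : ℕ → ℕ
varianceBound zero    = 0
varianceBound (suc r) = varianceBound r ℕ.+ sumOfSquaresFrom 1 r

Separated-scaledVariance-≥ : ∀ r (X : Fin r → ℚ) → Separated X → ιn (varianceBound r) ℚ.≤ scaledVariance X
Separated-scaledVariance-≥ zero    X sep = ℚ.≤-refl
Separated-scaledVariance-≥ (suc r) X sep with argmin X
... | i , min = begin
  ιn (varianceBound r ℕ.+ sumOfSquaresFrom 1 r)                      ≡⟨ ιn-+ (varianceBound r) _ ⟩
  ιn (varianceBound r) + ιn (sumOfSquaresFrom 1 r)                   ≤⟨ ℚ.+-mono-≤ rest nearest ⟩
  scaledVariance (X ∘ punchIn i) + sumℚ (λ k → sq (X (punchIn i k) - X i))  ≡⟨ scaledVariance-remove X i ⟨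
  scaledVariance X                                                    ∎
  where
  open ℚ.≤-Reasoning
  sep′ : Separated (X ∘ punchIn i)
  sep′ = Separated-punchIn {X = X} i sep
  rest : ιn (varianceBound r) ℚ.≤ scaledVariance (X ∘ punchIn i)
  rest = Separated-scaledVariance-≥ r (X ∘ punchIn i) sep′
  nearest : ιn (sumOfSquaresFrom 1 r) ℚ.≤ sumℚ (λ k → sq (X (punchIn i k) - X i))
  nearest = Separated-sumSq-≥ r (X ∘ punchIn i) (X i) 1 sep′ (Separated-min-gap i min sep)

sumOfSquaresFrom-suc : ∀ j r → sumOfSquaresFrom j (suc r) ≡ sumOfSquaresFrom j r ℕ.+ (j ℕ.+ r) ℕ.* (j ℕ.+ r)
sumOfSquaresFrom-suc j zero    = square j
  where
  square : ∀ j → j ℕ.* j ℕ.+ 0 ≡ 0 ℕ.+ (j ℕ.+ 0) ℕ.* (j ℕ.+ 0)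
  square = ℕ-Solver.solve-∀
sumOfSquaresFrom-suc j (suc r) =
  ≡.trans (cong (j ℕ.* j ℕ.+_) (sumOfSquaresFrom-suc (suc j) r)) (shuffle j r (sumOfSquaresFrom (suc j) r))
  where
  shuffle : ∀ j r s → j ℕ.* j ℕ.+ (s ℕ.+ (suc j ℕ.+ r) ℕ.* (suc j ℕ.+ r)) ≡
                      (j ℕ.* j ℕ.+ s) ℕ.+ (j ℕ.+ suc r) ℕ.* (j ℕ.+ suc r)
  shuffle = ℕ-Solver.solve-∀

sumOfSquares-closed : ∀ r → 6 ℕ.* sumOfSquaresFrom 1 r ≡ r ℕ.* (r ℕ.+ 1) ℕ.* (2 ℕ.* r ℕ.+ 1)
sumOfSquares-closed zero    = refl
sumOfSquares-closed (suc r) = begin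
  6 ℕ.* sumOfSquaresFrom 1 (suc r)                                 ≡⟨ cong (6 ℕ.*_) (sumOfSquaresFrom-suc 1 r) ⟩
  6 ℕ.* (sumOfSquaresFrom 1 r ℕ.+ suc r ℕ.* suc r)                   ≡⟨ ℕ.*-distribˡ-+ 6 (sumOfSquaresFrom 1 r) _ ⟩
  6 ℕ.* sumOfSquaresFrom 1 r ℕ.+ 6 ℕ.* (suc r ℕ.* suc r)             ≡⟨ cong (ℕ._+ 6 ℕ.* (suc r ℕ.* suc r)) (sumOfSquares-closed r) ⟩
  r ℕ.* (r ℕ.+ 1) ℕ.* (2 ℕ.* r ℕ.+ 1) ℕ.+ 6 ℕ.* (suc r ℕ.* suc r)    ≡⟨ step r ⟩
  suc r ℕ.* (suc r ℕ.+ 1) ℕ.* (2 ℕ.* suc r ℕ.+ 1)                   ∎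
  where
  open ≡.≡-Reasoning
  step : ∀ r → r ℕ.* (r ℕ.+ 1) ℕ.* (2 ℕ.* r ℕ.+ 1) ℕ.+ 6 ℕ.* (suc r ℕ.* suc r) ≡
               suc r ℕ.* (suc r ℕ.+ 1) ℕ.* (2 ℕ.* suc r ℕ.+ 1)
  step = ℕ-Solver.solve-∀

varianceBound-closed : ∀ r → 12 ℕ.* varianceBound r ℕ.+ r ℕ.* r ≡ r ℕ.* r ℕ.* r ℕ.* r
varianceBound-closed zero    = refl
varianceBound-closed (suc r) = begin
  12 ℕ.* (V ℕ.+ W) ℕ.+ suc r ℕ.* suc r                          ≡⟨ shuffle V W r ⟩
  (12 ℕ.* V ℕ.+ r ℕ.* r) ℕ.+ 2 ℕ.* (6 ℕ.* W) ℕ.+ (2 ℕ.* r ℕ.+ 1)  ≡⟨ cong₂ (λ x y → x ℕ.+ 2 ℕ.* y ℕ.+ (2 ℕ.* r ℕ.+ 1))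
                                                                          (varianceBound-closed r) (sumOfSquares-closed r) ⟩
  r ℕ.* r ℕ.* r ℕ.* r ℕ.+ 2 ℕ.* (r ℕ.* (r ℕ.+ 1) ℕ.* (2 ℕ.* r ℕ.+ 1)) ℕ.+ (2 ℕ.* r ℕ.+ 1)  ≡⟨ step r ⟩
  suc r ℕ.* suc r ℕ.* suc r ℕ.* suc r                            ∎
  where
  open ≡.≡-Reasoning
  V W : ℕ
  V = varianceBound r
  W = sumOfSquaresFrom 1 r
  shuffle : ∀ V W r → 12 ℕ.* (V ℕ.+ W) ℕ.+ suc r ℕ.* suc r ≡
                      (12 ℕ.* V ℕ.+ r ℕ.* r) ℕ.+ 2 ℕ.* (6 ℕ.* W) ℕ.+ (2 ℕ.* r ℕ.+ 1)
  shuffle = ℕ-Solver.solve-∀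
  step : ∀ r → r ℕ.* r ℕ.* r ℕ.* r ℕ.+ 2 ℕ.* (r ℕ.* (r ℕ.+ 1) ℕ.* (2 ℕ.* r ℕ.+ 1)) ℕ.+ (2 ℕ.* r ℕ.+ 1) ≡
               suc r ℕ.* suc r ℕ.* suc r ℕ.* suc r
  step = ℕ-Solver.solve-∀

packing-gap : ∀ {m Q} → 14 ℕ.≤ m → 4 ℕ.≤ Q →
              12 ℕ.* Q ℕ.* m ℕ.+ suc m ℕ.* suc m ℕ.< suc m ℕ.* suc m ℕ.* Q
packing-gap {m} {Q} 14≤m 4≤Q =
  subst₂ (λ m Q → 12 ℕ.* Q ℕ.* m ℕ.+ suc m ℕ.* suc m ℕ.< suc m ℕ.* suc m ℕ.* Q)
         (ℕ.m+[n∸m]≡n 14≤m) (ℕ.m+[n∸m]≡n 4≤Q) (gap (m ℕ.∸ 14) (Q ℕ.∸ 4))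
  where
  -- with m = 14 + a and Q = 4 + t the right side exceeds the left by 3 + 42a + 3a² + (57 + 18a + a²) t
  expand : ∀ a t → (15 ℕ.+ a) ℕ.* (15 ℕ.+ a) ℕ.* (4 ℕ.+ t) ≡
           suc (12 ℕ.* (4 ℕ.+ t) ℕ.* (14 ℕ.+ a) ℕ.+ (15 ℕ.+ a) ℕ.* (15 ℕ.+ a) ℕ.+
                (2 ℕ.+ 42 ℕ.* a ℕ.+ 3 ℕ.* a ℕ.* a ℕ.+ (57 ℕ.+ 18 ℕ.* a ℕ.+ a ℕ.* a) ℕ.* t))
  expand = ℕ-Solver.solve-∀
  gap : ∀ a t → 12 ℕ.* (4 ℕ.+ t) ℕ.* (14 ℕ.+ a) ℕ.+ (15 ℕ.+ a) ℕ.* (15 ℕ.+ a) ℕ.< (15 ℕ.+ a) ℕ.* (15 ℕ.+ a) ℕ.* (4 ℕ.+ t)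
  gap a t = ℕ.<-≤-trans (ℕ.s≤s (ℕ.m≤m+n _ _)) (ℕ.≤-reflexive (≡.sym (expand a t)))

packing-impossible : ∀ {m q} → 14 ℕ.≤ m → 2 ℕ.≤ q →
  ¬ (suc m ℕ.* suc m ℕ.* varianceBound q ℕ.≤ q ℕ.* q ℕ.* q ℕ.* q ℕ.* m)
packing-impossible {m} {q} 14≤m 2≤q bound = ℕ.<-irrefl refl (begin-strict
  n² ℕ.* (q ℕ.* q ℕ.* q ℕ.* q)                          ≡⟨ cong (n² ℕ.*_) (varianceBound-closed q) ⟨
  n² ℕ.* (12 ℕ.* varianceBound q ℕ.+ Q)                  ≡⟨ ℕ.*-distribˡ-+ n² _ Q ⟩
  n² ℕ.* (12 ℕ.* varianceBound q) ℕ.+ n² ℕ.* Q           ≤⟨ ℕ.+-monoˡ-≤ (n² ℕ.* Q) (scaled bound) ⟩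
  12 ℕ.* (Q ℕ.* Q ℕ.* m) ℕ.+ n² ℕ.* Q                    ≡⟨ regroup Q m n² ⟩
  (12 ℕ.* Q ℕ.* m ℕ.+ n²) ℕ.* Q                          <⟨ ℕ.*-monoˡ-< Q {{ℕ.>-nonZero (ℕ.<-≤-trans (ℕ.s≤s ℕ.z≤n) 4≤Q)}} (packing-gap 14≤m 4≤Q) ⟩
  n² ℕ.* Q ℕ.* Q                                         ≡⟨ square² n² q ⟩
  n² ℕ.* (q ℕ.* q ℕ.* q ℕ.* q)                          ∎)
  where
  open ℕ.≤-Reasoning
  n² Q : ℕ
  n² = suc m ℕ.* suc m
  Q = q ℕ.* q
  4≤Q : 4 ℕ.≤ Q
  4≤Q = ℕ.*-mono-≤ 2≤q 2≤q
  square² : ∀ x q → x ℕ.* (q ℕ.* q) ℕ.* (q ℕ.* q) ≡ x ℕ.* (q ℕ.* q ℕ.* q ℕ.* q)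
  square² = ℕ-Solver.solve-∀
  regroup : ∀ Q m x → 12 ℕ.* (Q ℕ.* Q ℕ.* m) ℕ.+ x ℕ.* Q ≡ (12 ℕ.* Q ℕ.* m ℕ.+ x) ℕ.* Q
  regroup = ℕ-Solver.solve-∀
  scaled : n² ℕ.* varianceBound q ℕ.≤ q ℕ.* q ℕ.* q ℕ.* q ℕ.* m →
           n² ℕ.* (12 ℕ.* varianceBound q) ℕ.≤ 12 ℕ.* (Q ℕ.* Q ℕ.* m)
  scaled b = subst₂ ℕ._≤_ (swap n² (varianceBound q)) (cong (12 ℕ.*_) (quartic q m)) (ℕ.*-monoʳ-≤ 12 b)
    where
    swap : ∀ x y → 12 ℕ.* (x ℕ.* y) ≡ x ℕ.* (12 ℕ.* y)
    swap = ℕ-Solver.solve-∀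
    quartic : ∀ q m → q ℕ.* q ℕ.* q ℕ.* q ℕ.* m ≡ q ℕ.* q ℕ.* (q ℕ.* q) ℕ.* m
    quartic = ℕ-Solver.solve-∀

coprime-gap : ∀ {q} p → Coprime ℤ.∣ p ∣ q → ∀ {k k′} → k ℕ.< q → k′ ℕ.< q → k ≢ k′ →
              ∀ w → + q ℤ.* w ℤ.+ (+ k ℤ.- + k′) ℤ.* p ≢ + 0
coprime-gap {q} p coprime {k} {k′} k<q k′<q k≢k′ w vanishes = ℕ.<-irrefl refl (ℕ.<-≤-trans ∣d∣<q q≤∣d∣)
  where
  d : ℤ
  d = + k ℤ.- + k′
  rearrange : ∀ a b c e → c ℤ.* e ℤ.- ℤ.- (a ℤ.* b) ≡ a ℤ.* b ℤ.+ c ℤ.* e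
  rearrange = ℤ-Solver.solve-∀
  dp≡-qw : d ℤ.* p ≡ ℤ.- (+ q ℤ.* w)
  dp≡-qw = ℤ.i-j≡0⇒i≡j _ _ (≡.trans (rearrange (+ q) w d p) vanishes)
  ∣p∣∣d∣≡∣w∣q : ℤ.∣ p ∣ ℕ.* ℤ.∣ d ∣ ≡ ℤ.∣ w ∣ ℕ.* q
  ∣p∣∣d∣≡∣w∣q = begin
    ℤ.∣ p ∣ ℕ.* ℤ.∣ d ∣          ≡⟨ ℕ.*-comm ℤ.∣ p ∣ ℤ.∣ d ∣ ⟩
    ℤ.∣ d ∣ ℕ.* ℤ.∣ p ∣          ≡⟨ ℤ.abs-* d p ⟨
    ℤ.∣ d ℤ.* p ∣                ≡⟨ cong ℤ.∣_∣ dp≡-qw ⟩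
    ℤ.∣ ℤ.- (+ q ℤ.* w) ∣        ≡⟨ ℤ.∣-i∣≡∣i∣ (+ q ℤ.* w) ⟩
    ℤ.∣ + q ℤ.* w ∣              ≡⟨ ℤ.abs-* (+ q) w ⟩
    q ℕ.* ℤ.∣ w ∣                ≡⟨ ℕ.*-comm q ℤ.∣ w ∣ ⟩
    ℤ.∣ w ∣ ℕ.* q                ∎
    where open ≡.≡-Reasoning
  ∣d∣≢0 : ℤ.∣ d ∣ ≢ 0
  ∣d∣≢0 ∣d∣≡0 = k≢k′ (ℤ.+-injective (ℤ.i-j≡0⇒i≡j (+ k) (+ k′) (ℤ.∣i∣≡0⇒i≡0 ∣d∣≡0)))
  q≤∣d∣ : q ℕ.≤ ℤ.∣ d ∣
  q≤∣d∣ = ∣⇒≤ {{ℕ.≢-nonZero ∣d∣≢0}} (coprime-divisor (Coprime.sym coprime) (divides ℤ.∣ w ∣ ∣p∣∣d∣≡∣w∣q))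
  ∣d∣<q : ℤ.∣ d ∣ ℕ.< q
  ∣d∣<q = subst (ℕ._< q) (cong ℤ.∣_∣ (≡.sym (ℤ.m-n≡m⊖n k k′))) (ℕ.≤-<-trans (ℤ.∣m⊝n∣≤m⊔n k k′) (ℕ.⊔-lub k<q k′<q))

IsInteger : ℚ → Set
IsInteger x = ∃ λ k → x ≡ ι k

IsInteger-+ : ∀ {x y} → IsInteger x → IsInteger y → IsInteger (x + y)
IsInteger-+ (k , x≡k) (l , y≡l) = k ℤ.+ l , ≡.trans (cong₂ _+_ x≡k y≡l) (≡.sym (ι-+ k l))

nonzero-integer-≥1 : ∀ {N} → N ≢ + 0 → 1ℚ ℚ.≤ ι N ⊎ 1ℚ ℚ.≤ - ι N
nonzero-integer-≥1 {+ zero}   N≢0 = ⊥-elim (N≢0 refl)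
nonzero-integer-≥1 {+ suc n}  _   = inj₁ (ι-mono-≤ {+ 1} {+ suc n} (ℤ.+≤+ (ℕ.s≤s ℕ.z≤n)))
nonzero-integer-≥1 { -[1+ n ]} _  = inj₂ (subst (1ℚ ℚ.≤_) (ι-neg -[1+ n ]) (ι-mono-≤ {+ 1} {+ suc n} (ℤ.+≤+ (ℕ.s≤s ℕ.z≤n))))

IsInteger-or-↧≥2 : ∀ r → IsInteger r ⊎ 2 ℕ.≤ ↧ₙ r
IsInteger-or-↧≥2 r@(mkℚ p zero    _) = inj₁ (p , ≡.trans (≡.sym (ℚ.*-identityʳ r)) (*-denominator r))
IsInteger-or-↧≥2   (mkℚ p (suc d) _) = inj₂ (ℕ.s≤s (ℕ.s≤s ℕ.z≤n))

integer-gaps⇒Separated : ∀ {r} {X : Fin r → ℚ} → (∀ i j → i ≢ j → ∃ λ N → N ≢ + 0 × X j - X i ≡ ι N) → Separated X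
integer-gaps⇒Separated {X = X} gaps i j i≢j with gaps i j i≢j
... | N , N≢0 , gap with nonzero-integer-≥1 N≢0
...   | inj₁ 1≤N  = inj₁ (subst (1ℚ ℚ.≤_) (≡.sym gap) 1≤N)
...   | inj₂ 1≤-N = inj₂ (subst (1ℚ ℚ.≤_) (≡.trans (cong -_ (≡.sym gap)) (negate (X j) (X i))) 1≤-N)
  where
  negate : ∀ x y → - (x - y) ≡ y - x
  negate = solve-∀ ℚ-ring

∙-toℚ-δ : ∀ {k} (v : Fin k → ℚ) c → v ∙ toℚ (δ c) ≡ v c
∙-toℚ-δ v c = ≡.trans (sumℚ-single _ c off) (≡.trans (cong (λ k → v c * ι k) (δ-diag c)) (ℚ.*-identityʳ (v c)))
  where
  off : ∀ i → c ≢ i → v i * ι (δ c i) ≡ 0ℚ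
  off i c≢i = ≡.trans (cong (λ k → v i * ι k) (δ-off c≢i)) (ℚ.*-zeroʳ (v i))

∙-toℚ-+ : ∀ {k} (v : Fin k → ℚ) x y → v ∙ toℚ (λ i → x i ℤ.+ y i) ≡ v ∙ toℚ x + v ∙ toℚ y
∙-toℚ-+ v x y = ≡.trans (sumℚ-cong (λ i → ≡.trans (cong (v i *_) (ι-+ (x i) (y i))) (ℚ.*-distribˡ-+ (v i) _ _)))
                       (sumℚ-+ (λ i → v i * ι (x i)) (λ i → v i * ι (y i)))

∙-toℚ-- : ∀ {k} (v : Fin k → ℚ) x y → v ∙ toℚ (λ i → x i ℤ.- y i) ≡ v ∙ toℚ x - v ∙ toℚ y
∙-toℚ-- v x y = ≡.trans (sumℚ-cong (λ i → ≡.trans (cong (v i *_) (ι-- (x i) (y i))) (distrib (v i) _ _)))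
                       (sumℚ-- (λ i → v i * ι (x i)) (λ i → v i * ι (y i)))
  where
  distrib : ∀ a b c → a * (b - c) ≡ a * b - a * c
  distrib = solve-∀ ℚ-ring

ones-∙ : ∀ {k} (x : Fin k → ℤ) → (λ _ → 1ℚ) ∙ toℚ x ≡ ι (sumℤ x)
ones-∙ x = ≡.trans (sumℚ-cong (λ i → ℚ.*-identityˡ (ι (x i)))) (sumℚ-ι x)

A-dual : ∀ n (v : Fin (suc n) → ℚ) → inV (suc n) v → (∀ i → IsInteger (v i - v zero)) → Dual (suc n) (A (suc n)) v
A-dual n v v∈V int = v∈V , λ x x∈A → sumℤ (λ i → k i ℤ.* x i) , (begin
  v ∙ toℚ x                                                   ≡⟨ sumℚ-cong (λ i → split (v i) (v zero) (ι (x i))) ⟩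
  sumℚ (λ i → v zero * ι (x i) + (v i - v zero) * ι (x i))    ≡⟨ sumℚ-+ (λ i → v zero * ι (x i)) (λ i → (v i - v zero) * ι (x i)) ⟩
  sumℚ (λ i → v zero * ι (x i)) + sumℚ (λ i → (v i - v zero) * ι (x i))
    ≡⟨ cong₂ _+_ (≡.trans (sumℚ-*ˡ (v zero) (toℚ x)) (cong (v zero *_) (≡.trans (sumℚ-ι x) (cong ι x∈A))))
                 (sumℚ-cong (λ i → ≡.trans (cong (_* ι (x i)) (proj₂ (int i))) (≡.sym (ι-* (k i) (x i))))) ⟩
  v zero * 0ℚ + sumℚ (λ i → ι (k i ℤ.* x i))                  ≡⟨ cong₂ _+_ (ℚ.*-zeroʳ (v zero)) (sumℚ-ι (λ i → k i ℤ.* x i)) ⟩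
  0ℚ + ι (sumℤ (λ i → k i ℤ.* x i))                           ≡⟨ ℚ.+-identityˡ _ ⟩
  ι (sumℤ (λ i → k i ℤ.* x i))                                ∎)
  where
  open ≡.≡-Reasoning
  k : Fin (suc n) → ℤ
  k i = proj₁ (int i)
  split : ∀ a b c → a * c ≡ b * c + (a - b) * c
  split = solve-∀ ℚ-ring

sumℚ-toℚ-δ : ∀ {k} (c : Fin k) → sumℚ (toℚ (δ c)) ≡ 1ℚ
sumℚ-toℚ-δ c = ≡.trans (sumℚ-cong (λ i → ≡.sym (ℚ.*-identityˡ (ι (δ c i))))) (∙-toℚ-δ (λ _ → 1ℚ) c)

module MinimalVector (m : ℕ) where

  1/n : ℚ
  1/n = + 1 ℚ./ suc m

  1/n*n : 1/n * ιn (suc m) ≡ 1ℚ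
  1/n*n = /-*-cancel (+ 1) m

  e : Fin (suc m) → ℚ
  e i = ι (δ zero i) - 1/n

  e∈V : inV (suc m) e
  e∈V = begin
    sumℚ e                                   ≡⟨ sumℚ-- d (λ _ → 1/n) ⟩
    sumℚ d - sumℚ {suc m} (λ _ → 1/n)        ≡⟨ cong₂ _-_ (sumℚ-toℚ-δ {suc m} zero) (≡.trans (sumℚ-const (suc m) 1/n) (ℚ.*-comm (ιn (suc m)) 1/n)) ⟩
    1ℚ - 1/n * ιn (suc m)                    ≡⟨ cong (λ t → 1ℚ - t) 1/n*n ⟩
    1ℚ - 1ℚ                                  ≡⟨ ℚ.+-inverseʳ 1ℚ ⟩
    0ℚ                                       ∎
    where
    open ≡.≡-Reasoning
    d : Fin (suc m) → ℚ
    d = toℚ (δ zero)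

  e∈A# : Dual (suc m) (A (suc m)) e
  e∈A# = A-dual m e e∈V (λ i → δ zero i ℤ.- + 1 , ≡.trans (cancel (ι (δ zero i)) 1/n) (≡.sym (ι-- (δ zero i) (+ 1))))
    where
    cancel : ∀ a u → (a - u) - (1ℚ - u) ≡ a - 1ℚ
    cancel = solve-∀ ℚ-ring

  -- the index only witnesses m ≥ 1: for n = 1, e = 0
  e≢0 : Fin m → NonZeroVec e
  e≢0 o e≡0 = 1≢0 (≡.trans (≡.sym (difference 1/n)) (cong₂ _-_ (e≡0 zero) (e≡0 (suc o))))
    where
    difference : ∀ u → (1ℚ - u) - (0ℚ - u) ≡ 1ℚ
    difference = solve-∀ ℚ-ring
    1≢0 : 1ℚ ≢ 0ℚ - 0ℚ
    1≢0 ()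

  n*e∙e : ιn (suc m) * (e ∙ e) ≡ ιn m
  n*e∙e = begin
    N * (e ∙ e)                                        ≡⟨ cong (N *_) (sumℚ-sq-shift d 1/n) ⟩
    N * (d ∙ d - (1/n + 1/n) * sumℚ d + N * sq 1/n)    ≡⟨ cong₂ (λ s t → N * (s - (1/n + 1/n) * t + N * sq 1/n))
                                                                (∙-toℚ-δ d zero) (sumℚ-toℚ-δ {suc m} zero) ⟩
    N * (1ℚ - (1/n + 1/n) * 1ℚ + N * sq 1/n)           ≡⟨ expand N 1/n ⟩
    N - (1/n * N + 1/n * N) + (1/n * N) * (1/n * N)    ≡⟨ cong (λ w → N - (w + w) + w * w) 1/n*n ⟩
    N - (1ℚ + 1ℚ) + 1ℚ * 1ℚ                           ≡⟨ cong (λ w → w - (1ℚ + 1ℚ) + 1ℚ * 1ℚ) (ιn-suc m) ⟩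
    (1ℚ + ιn m) - (1ℚ + 1ℚ) + 1ℚ * 1ℚ                 ≡⟨ collapse (ιn m) ⟩
    ιn m                                               ∎
    where
    open ≡.≡-Reasoning
    N : ℚ
    N = ιn (suc m)
    d : Fin (suc m) → ℚ
    d = toℚ (δ zero)
    expand : ∀ N u → N * (1ℚ - (u + u) * 1ℚ + N * (u * u)) ≡ N - (u * N + u * N) + (u * N) * (u * N)
    expand = solve-∀ ℚ-ring
    collapse : ∀ x → (1ℚ + x) - (1ℚ + 1ℚ) + 1ℚ * 1ℚ ≡ x
    collapse = solve-∀ ℚ-ring

Dual-antitone : ∀ {a b n} {L : (Fin n → ℤ) → Set a} {L′ : (Fin n → ℤ) → Set b} →
                (∀ {x} → L x → L′ x) → ∀ w → Dual n L′ w → Dual n L w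
Dual-antitone L⊆L′ w (w∈V , integral) = w∈V , λ x x∈L → integral x (L⊆L′ x∈L)

relation : ∀ {m} → Fin (suc m) → Fin (suc m) → Fin (suc m) → Fin (suc m) → ℤ
relation c b h i = δ c i ℤ.+ δ zero i ℤ.- δ b i ℤ.- δ h i

∙-relation : ∀ {m} (v : Fin (suc m) → ℚ) c b h → v ∙ toℚ (relation c b h) ≡ v c + v zero - v b - v h
∙-relation v c b h = begin
  v ∙ toℚ (relation c b h)
    ≡⟨ ∙-toℚ-- v (λ i → δ c i ℤ.+ δ zero i ℤ.- δ b i) (δ h) ⟩
  v ∙ toℚ (λ i → δ c i ℤ.+ δ zero i ℤ.- δ b i) - v ∙ toℚ (δ h)
    ≡⟨ cong (_- v ∙ toℚ (δ h)) (∙-toℚ-- v (λ i → δ c i ℤ.+ δ zero i) (δ b)) ⟩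
  v ∙ toℚ (λ i → δ c i ℤ.+ δ zero i) - v ∙ toℚ (δ b) - v ∙ toℚ (δ h)
    ≡⟨ cong (λ t → t - v ∙ toℚ (δ b) - v ∙ toℚ (δ h)) (∙-toℚ-+ v (δ c) (δ zero)) ⟩
  v ∙ toℚ (δ c) + v ∙ toℚ (δ zero) - v ∙ toℚ (δ b) - v ∙ toℚ (δ h)
    ≡⟨ cong₂ _-_ (cong₂ _-_ (cong₂ _+_ (∙-toℚ-δ v c) (∙-toℚ-δ v zero)) (∙-toℚ-δ v b)) (∙-toℚ-δ v h) ⟩
  v c + v zero - v b - v h ∎
  where open ≡.≡-Reasoning

relation∈A : ∀ {m} (c b h : Fin (suc m)) → A (suc m) (relation c b h)
relation∈A c b h = ι-injective (≡.trans (≡.sym (ones-∙ (relation c b h))) (∙-relation (λ _ → 1ℚ) c b h))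

module _ {c ℓ : Level} (G : AbelianGroup c ℓ) {m : ℕ} (enum : Enumeration G m) where
  open AbelianGroup G
    using (_≈_; ε; _⁻¹; setoid; reflexive; ∙-cong; ∙-congˡ; ∙-congʳ; ⁻¹-cong; assoc; identityʳ; inverseˡ; inverseʳ)
    renaming (Carrier to ∣G∣; refl to ≈-refl; sym to ≈-sym; trans to ≈-trans; _∙_ to _⊕_)
  open Enumeration enum
  open import Algebra.Properties.AbelianGroup G using (⁻¹-∙-comm)
  open import Algebra.Properties.CommutativeSemigroup (AbelianGroup.commutativeSemigroup G) using (x∙yz≈xz∙y)
  open MinimalVector m using (e; n*e∙e)

  groupValue : (Fin (suc m) → ℤ) → ∣G∣
  groupValue x = sumG G (λ j → intMul G (x (suc j)) (g (suc j)))

  groupValue-+ : ∀ x y → groupValue (λ i → x i ℤ.+ y i) ≈ groupValue x ⊕ groupValue y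
  groupValue-+ x y = ≈-trans (sumG-cong G (λ j → intMul-+ G (x (suc j)) (y (suc j)) (g (suc j))))
                         (sumG-⊕ G (λ j → intMul G (x (suc j)) (g (suc j))) (λ j → intMul G (y (suc j)) (g (suc j))))

  groupValue-- : ∀ x y → groupValue (λ i → x i ℤ.- y i) ≈ groupValue x ⊕ groupValue y ⁻¹
  groupValue-- x y = ≈-trans (sumG-cong G (λ j → intMul-- G (x (suc j)) (y (suc j)) (g (suc j))))
                         (≈-trans (sumG-⊕ G (λ j → intMul G (x (suc j)) (g (suc j))) (λ j → intMul G (y (suc j)) (g (suc j)) ⁻¹))
                                  (∙-congˡ (sumG-⁻¹ G (λ j → intMul G (y (suc j)) (g (suc j))))))

  groupValue-δ : ∀ c → groupValue (δ c) ≈ g c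
  groupValue-δ zero    = ≈-trans (sumG-ε G {m} _ (λ _ → ≈-refl)) (≈-sym g₁≈0)
  groupValue-δ (suc c) = ≈-trans (sumG-single G _ c off)
    (≈-trans (reflexive (cong (λ k → intMul G k (g (suc c))) (δ-diag c))) (identityʳ _))
    where
    off : ∀ j → c ≢ j → intMul G (δ c j) (g (suc j)) ≈ ε
    off j c≢j = reflexive (cong (λ k → intMul G k (g (suc j))) (δ-off c≢j))

  relation∈L : ∀ c b h → g c ≈ g b ⊕ g h → L G m g (relation c b h)
  relation∈L c b h gc≈gb+gh = relation∈A c b h , (begin
    groupValue (relation c b h)                                             ≈⟨ groupValue-- (λ i → δ c i ℤ.+ δ zero i ℤ.- δ b i) (δ h) ⟩
    groupValue (λ i → δ c i ℤ.+ δ zero i ℤ.- δ b i) ⊕ groupValue (δ h) ⁻¹       ≈⟨ ∙-congʳ (groupValue-- (λ i → δ c i ℤ.+ δ zero i) (δ b)) ⟩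
    groupValue (λ i → δ c i ℤ.+ δ zero i) ⊕ groupValue (δ b) ⁻¹ ⊕ groupValue (δ h) ⁻¹ ≈⟨ ∙-congʳ (∙-congʳ (groupValue-+ (δ c) (δ zero))) ⟩
    groupValue (δ c) ⊕ groupValue (δ zero) ⊕ groupValue (δ b) ⁻¹ ⊕ groupValue (δ h) ⁻¹
      ≈⟨ ∙-cong (∙-cong (∙-cong (groupValue-δ c) (groupValue-δ zero)) (⁻¹-cong (groupValue-δ b))) (⁻¹-cong (groupValue-δ h)) ⟩
    g c ⊕ g zero ⊕ g b ⁻¹ ⊕ g h ⁻¹                                        ≈⟨ assoc _ _ _ ⟩
    (g c ⊕ g zero) ⊕ (g b ⁻¹ ⊕ g h ⁻¹)                                    ≈⟨ ∙-cong (∙-congˡ g₁≈0) (⁻¹-∙-comm (g b) (g h)) ⟩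
    (g c ⊕ ε) ⊕ (g b ⊕ g h) ⁻¹                                            ≈⟨ ∙-cong (identityʳ (g c)) (⁻¹-cong (≈-sym gc≈gb+gh)) ⟩
    g c ⊕ g c ⁻¹                                                          ≈⟨ inverseʳ (g c) ⟩
    ε                                                                     ∎)
    where open ≈-Reasoning setoid

  dual-additive : ∀ v → Dual (suc m) (L G m g) v → ∀ {c b h} → g c ≈ g b ⊕ g h →
                  IsInteger (v c + v zero - v b - v h)
  dual-additive v (_ , integral) {c} {b} {h} gc≈gb+gh =
    map₂ (≡.trans (≡.sym (∙-relation v c b h))) (integral (relation c b h) (relation∈L c b h gc≈gb+gh))

  index : ∣G∣ → Fin (suc m)
  index a = proj₁ (surj a)

  g-index : ∀ a → g (index a) ≈ a
  g-index a = proj₂ (surj a)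

  translate : ∣G∣ → Fin (suc m) → Fin (suc m)
  translate a b = index (g b ⊕ a)

  translate-cancel : ∀ {a a′} → a ⊕ a′ ≈ ε → ∀ b → translate a′ (translate a b) ≡ b
  translate-cancel {a} {a′} a⊕a′≈ε b = inj _ _ (begin
    g (index (g (index (g b ⊕ a)) ⊕ a′))  ≈⟨ g-index _ ⟩
    g (index (g b ⊕ a)) ⊕ a′             ≈⟨ ∙-congʳ (g-index _) ⟩
    g b ⊕ a ⊕ a′                         ≈⟨ assoc _ _ _ ⟩
    g b ⊕ (a ⊕ a′)                       ≈⟨ ∙-congˡ a⊕a′≈ε ⟩
    g b ⊕ ε                              ≈⟨ identityʳ _ ⟩
    g b                                  ∎)
    where open ≈-Reasoning setoid

  translation : ∣G∣ → Permutation′ (suc m)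
  translation a = permutation (translate a) (translate (a ⁻¹))
    (translate-cancel (inverseˡ a)) (translate-cancel (inverseʳ a))

  translate-ε : ∀ b → translate ε b ≡ b
  translate-ε b = inj _ _ (≈-trans (g-index (g b ⊕ ε)) (identityʳ (g b)))

  module Orbit {v : Fin (suc m) → ℚ} (v∈L# : Dual (suc m) (L G m g) v) (h₀ : Fin (suc m)) where

    r : ℚ
    r = v h₀ - v zero

    shift : ℕ → Fin (suc m) → Fin (suc m)
    shift k = translate (natMul G k (g h₀))

    shift-drift : ∀ k b → IsInteger (v (shift k b) - v b - ιn k * r)
    shift-drift zero    b = + 0 , ≡.trans (cong (λ b′ → v b′ - v b - 0ℚ * r) (translate-ε b)) (vanish (v b) r)
      where
      vanish : ∀ x r → x - x - 0ℚ * r ≡ 0ℚ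
      vanish = solve-∀ ℚ-ring
    shift-drift (suc k) b = subst IsInteger
      (≡.trans (telescope (v (shift (suc k) b)) (v (shift k b)) (v b) (v h₀) (v zero) (ιn k))
               (cong (λ t → v (shift (suc k) b) - v b - t * r) (≡.sym (ιn-suc k))))
      (IsInteger-+ (dual-additive v v∈L# step) (shift-drift k b))
      where
      telescope : ∀ x x′ xb h z K → (x + z - x′ - h) + (x′ - xb - K * (h - z)) ≡ x - xb - (1ℚ + K) * (h - z)
      telescope = solve-∀ ℚ-ring
      step : g (shift (suc k) b) ≈ g (shift k b) ⊕ g h₀
      step = begin
        g (shift (suc k) b)                    ≈⟨ g-index _ ⟩
        g b ⊕ (g h₀ ⊕ natMul G k (g h₀))       ≈⟨ x∙yz≈xz∙y _ _ _ ⟩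
        (g b ⊕ natMul G k (g h₀)) ⊕ g h₀       ≈⟨ ∙-congʳ (g-index _) ⟨
        g (shift k b) ⊕ g h₀                   ∎
        where open ≈-Reasoning setoid

    p : ℤ
    p = ↥ r

    q : ℕ
    q = ↧ₙ r

    drift : ℕ → Fin (suc m) → ℤ
    drift k b = proj₁ (shift-drift k b)

    orbitPoints : Fin (suc m) → Fin q → ℚ
    orbitPoints b k = ιn q * v (shift (toℕ k) b)

    orbit-gap : ∀ b k k′ → orbitPoints b k - orbitPoints b k′ ≡
                ι (+ q ℤ.* (drift (toℕ k) b ℤ.- drift (toℕ k′) b) ℤ.+ (+ toℕ k ℤ.- + toℕ k′) ℤ.* p)
    orbit-gap b k k′ = begin
      Q * v (shift K b) - Q * v (shift K′ b)
        ≡⟨ regroup Q (v (shift K b)) (v (shift K′ b)) (v b) (ιn K) (ιn K′) r ⟩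
      Q * ((v (shift K b) - v b - ιn K * r) - (v (shift K′ b) - v b - ιn K′ * r)) + (ιn K - ιn K′) * (r * Q)
        ≡⟨ cong₂ (λ s t → Q * (s - t) + (ιn K - ιn K′) * (r * Q)) (proj₂ (shift-drift K b)) (proj₂ (shift-drift K′ b)) ⟩
      Q * (ι (drift K b) - ι (drift K′ b)) + (ιn K - ιn K′) * (r * Q)
        ≡⟨ cong₂ (λ s t → Q * s + t * (r * Q)) (ι-- (drift K b) (drift K′ b)) (ι-- (+ K) (+ K′)) ⟨
      Q * ι (drift K b ℤ.- drift K′ b) + ι (+ K ℤ.- + K′) * (r * Q)
        ≡⟨ cong (λ t → Q * ι (drift K b ℤ.- drift K′ b) + ι (+ K ℤ.- + K′) * t) (*-denominator r) ⟩
      Q * ι (drift K b ℤ.- drift K′ b) + ι (+ K ℤ.- + K′) * ι p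
        ≡⟨ cong₂ _+_ (ι-* (+ q) (drift K b ℤ.- drift K′ b)) (ι-* (+ K ℤ.- + K′) p) ⟨
      ι (+ q ℤ.* (drift K b ℤ.- drift K′ b)) + ι ((+ K ℤ.- + K′) ℤ.* p)
        ≡⟨ ι-+ (+ q ℤ.* (drift K b ℤ.- drift K′ b)) ((+ K ℤ.- + K′) ℤ.* p) ⟨
      ι (+ q ℤ.* (drift K b ℤ.- drift K′ b) ℤ.+ (+ K ℤ.- + K′) ℤ.* p) ∎
      where
      open ≡.≡-Reasoning
      Q : ℚ
      Q = ιn q
      K K′ : ℕ
      K = toℕ k
      K′ = toℕ k′
      regroup : ∀ Q x x′ vb K K′ r → Q * x - Q * x′ ≡ Q * ((x - vb - K * r) - (x′ - vb - K′ * r)) + (K - K′) * (r * Q)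
      regroup = solve-∀ ℚ-ring

    orbit-separated : ∀ b → Separated (orbitPoints b)
    orbit-separated b = integer-gaps⇒Separated {X = orbitPoints b} λ k k′ k≢k′ →
      _ , coprime-gap p (↥-↧-coprime r) (Fin.toℕ<n k′) (Fin.toℕ<n k) (k≢k′ ∘ ≡.sym ∘ Fin.toℕ-injective)
                      (drift (toℕ k′) b ℤ.- drift (toℕ k) b) , orbit-gap b k′ k

    orbitEnergy : Fin (suc m) → ℚ
    orbitEnergy b = sumℚ (λ (k : Fin q) → sq (v (shift (toℕ k) b)))

    orbit-bound : ∀ b → ιn (varianceBound q) ℚ.≤ ιn q * (ιn q * ιn q) * orbitEnergy b
    orbit-bound b = begin
      ιn (varianceBound q)                                       ≤⟨ Separated-scaledVariance-≥ q (orbitPoints b) (orbit-separated b) ⟩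
      ιn q * sumℚ (λ k → sq (orbitPoints b k)) - sq (sumℚ (orbitPoints b))   ≤⟨ -sq-≤ _ (sumℚ (orbitPoints b)) ⟩
      ιn q * sumℚ (λ k → sq (orbitPoints b k))                         ≡⟨ cong (ιn q *_) (sumℚ-cong {q} (λ k → square-* (ιn q) (v (shift (toℕ k) b)))) ⟩
      ιn q * sumℚ (λ (k : Fin q) → ιn q * ιn q * sq (v (shift (toℕ k) b)))  ≡⟨ cong (ιn q *_) (sumℚ-*ˡ (ιn q * ιn q) (λ (k : Fin q) → sq (v (shift (toℕ k) b)))) ⟩
      ιn q * (ιn q * ιn q * orbitEnergy b)                       ≡⟨ ℚ.*-assoc (ιn q) (ιn q * ιn q) _ ⟨
      ιn q * (ιn q * ιn q) * orbitEnergy b                       ∎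
      where
      open ℚ.≤-Reasoning
      square-* : ∀ a x → (a * x) * (a * x) ≡ a * a * (x * x)
      square-* = solve-∀ ℚ-ring

    orbits-cover : sumℚ orbitEnergy ≡ ιn q * (v ∙ v)
    orbits-cover = begin
      sumℚ (λ b → sumℚ (λ (k : Fin q) → sq (v (shift (toℕ k) b))))  ≡⟨ sumℚ-comm (λ b (k : Fin q) → sq (v (shift (toℕ k) b))) ⟩
      sumℚ (λ (k : Fin q) → sumℚ (λ b → sq (v (shift (toℕ k) b))))  ≡⟨ sumℚ-cong {q} (λ k → sumℚ-permute (sq ∘ v) (translation (natMul G (toℕ k) (g h₀)))) ⟩
      sumℚ {q} (λ _ → v ∙ v)                                        ≡⟨ sumℚ-const q (v ∙ v) ⟩
      ιn q * (v ∙ v)                                                ∎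
      where open ≡.≡-Reasoning

    dual-norm-bound : ιn (suc m) * ιn (varianceBound q) ℚ.≤ ιn q * (ιn q * ιn q) * (ιn q * (v ∙ v))
    dual-norm-bound = subst₂ ℚ._≤_ (sumℚ-const (suc m) (ιn (varianceBound q)))
      (≡.trans (sumℚ-*ˡ (ιn q * (ιn q * ιn q)) orbitEnergy) (cong (ιn q * (ιn q * ιn q) *_) orbits-cover))
      (sumℚ-mono-≤ orbit-bound)

    q⁴ : ℕ
    q⁴ = q ℕ.* q ℕ.* q ℕ.* q

    packing-bound : v ∙ v ℚ.≤ e ∙ e → suc m ℕ.* suc m ℕ.* varianceBound q ℕ.≤ q⁴ ℕ.* m
    packing-bound short = ιn-cancel-≤ (begin
      ιn (suc m ℕ.* suc m ℕ.* varianceBound q)  ≡⟨ ≡.trans (ιn-* (suc m ℕ.* suc m) (varianceBound q)) (cong (_* ιn (varianceBound q)) (ιn-* (suc m) (suc m))) ⟩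
      N * N * ιn (varianceBound q)              ≡⟨ ℚ.*-assoc N N (ιn (varianceBound q)) ⟩
      N * (N * ιn (varianceBound q))            ≤⟨ ℚ.*-monoˡ-≤-nonNeg N {{N≥0}} dual-norm-bound ⟩
      N * (Q * (Q * Q) * (Q * (v ∙ v)))         ≡⟨ regroup N Q (v ∙ v) ⟩
      Q * Q * Q * Q * (N * (v ∙ v))             ≡⟨ cong (_* (N * (v ∙ v))) ιn-q⁴ ⟨
      ιn q⁴ * (N * (v ∙ v))                     ≤⟨ ℚ.*-monoˡ-≤-nonNeg (ιn q⁴) {{q⁴≥0}} (ℚ.*-monoˡ-≤-nonNeg N {{N≥0}} short) ⟩
      ιn q⁴ * (N * (e ∙ e))                     ≡⟨ cong (ιn q⁴ *_) n*e∙e ⟩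
      ιn q⁴ * ιn m                              ≡⟨ ιn-* q⁴ m ⟨
      ιn (q⁴ ℕ.* m)                             ∎)
      where
      open ℚ.≤-Reasoning
      N Q : ℚ
      N = ιn (suc m)
      Q = ιn q
      N≥0 : ℚ.NonNegative N
      N≥0 = ℚ.nonNegative (ιn-nonNeg (suc m))
      q⁴≥0 : ℚ.NonNegative (ιn q⁴)
      q⁴≥0 = ℚ.nonNegative (ιn-nonNeg q⁴)
      ιn-q⁴ : ιn q⁴ ≡ Q * Q * Q * Q
      ιn-q⁴ = ≡.trans (ιn-* (q ℕ.* q ℕ.* q) q) (cong (_* Q) (≡.trans (ιn-* (q ℕ.* q) q) (cong (_* Q) (ιn-* q q))))
      regroup : ∀ N Q x → N * (Q * (Q * Q) * (Q * x)) ≡ Q * Q * Q * Q * (N * x)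
      regroup = solve-∀ ℚ-ring

  short-dual-vector∈A# : 14 ℕ.≤ m → ∀ v → Dual (suc m) (L G m g) v → v ∙ v ℚ.≤ e ∙ e → Dual (suc m) (A (suc m)) v
  short-dual-vector∈A# 14≤m v v∈L# short = A-dual m v (proj₁ v∈L#) integral
    where
    integral : ∀ i → IsInteger (v i - v zero)
    integral i with IsInteger-or-↧≥2 (v i - v zero)
    ... | inj₁ integer = integer
    ... | inj₂ 2≤q     = ⊥-elim (packing-impossible 14≤m 2≤q (Orbit.packing-bound {v} v∈L# i short))

theorem3p3 : ∀ {c ℓ : Level} (G : AbelianGroup c ℓ) (m : ℕ) → 15 ≤ suc m →
    (e : Enumeration G m) →
    ∀ v → S (suc m) (Dual (suc m) (L G m (Enumeration.g e))) v ⇔ S (suc m) (Dual (suc m) (A (suc m))) v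
theorem3p3 {ℓ = ℓ} G m (ℕ.s≤s 14≤m) enum v = mk⇔ forward backward
  where
  open MinimalVector m using (e; e∈A#; e≢0)
  L# : (Fin (suc m) → ℚ) → Set ℓ
  L# = Dual (suc m) (L G m (Enumeration.g enum))
  A# : (Fin (suc m) → ℚ) → Set
  A# = Dual (suc m) (A (suc m))

  A#⊆L# : ∀ w → A# w → L# w
  A#⊆L# = Dual-antitone proj₁

  e≠0 : NonZeroVec e
  e≠0 = e≢0 (fromℕ< (ℕ.<-≤-trans (ℕ.s≤s ℕ.z≤n) 14≤m))

  short⇒A# : ∀ w → L# w → w ∙ w ℚ.≤ e ∙ e → A# w
  short⇒A# = short-dual-vector∈A# G enum 14≤m

  forward : S (suc m) L# v → S (suc m) A# v
  forward (v∈L# , v≠0 , minimal) =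
    short⇒A# v v∈L# (minimal e (A#⊆L# e e∈A#) e≠0) , v≠0 , λ w w∈A# w≠0 → minimal w (A#⊆L# w w∈A#) w≠0

  backward : S (suc m) A# v → S (suc m) L# v
  backward (v∈A# , v≠0 , minimal) = A#⊆L# v v∈A# , v≠0 , λ w w∈L# w≠0 →
    [ (λ short → minimal w (short⇒A# w w∈L# short) w≠0) , ℚ.≤-trans (minimal e e∈A# e≠0) ]′ (ℚ.≤-total (w ∙ w) (e ∙ e))
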